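{- Let $n,m\ge0$, $\mathbf{x}=(x_1,\dots,x_n)$, $\mathbf{z}=(z_1,\dots,z_m)$, and let $\lambda=(\lambda_1,\dots,\lambda_n,0,\dots,0)$ be a partition with $m$ trailing zeros (so $n+m$ parts). Then $$o_\lambda(\mathbf{x}^{\pm};\mathbf{z})=\det\big(h'_{\lambda_i-i+j}(\mathbf{x}^{\pm};\mathbf{z})+\delta_{j>1}h'_{\lambda_i-i-j+2}(\mathbf{x}^{\pm};\mathbf{z})\big)_{i,j=1}^n,$$ i.e. the universal orthogonal function equals Krattenthaler's intermediate orthogonal character.
   Context: $h_k(\mathbf{x}^{\pm};\mathbf{z})$ is defined by $\prod_{i=1}^n\frac{1}{(1-x_iw)(1-x_i^{ -1}w)}\prod_{j=1}^m\frac{1}{1-z_jw}=\sum_{k\in\mathbb{Z}}h_k(\mathbf{x}^{\pm};\mathbf{z})w^k$ ($h_k=0$ for $k<0$), and $h'_k=h_k-h_{k-2}$. The universal orthogonal function is $o_\lambda(\mathbf{x}^{\pm};\mathbf{z})=\det\big(h_{\lambda_i-i+j}(\mathbf{x}^{\pm};\mathbf{z})-h_{\lambda_i-i-j}(\mathbf{x}^{\pm};\mathbf{z})\big)_{i,j=1}^{n+m}$ for $\lambda=(\lambda_1,\dots,\lambda_{n+m})$. $\delta_{j>1}$ is $1$ if $j>1$, else $0$. -}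

module Defs where

open import Algebra.Bundles using (CommutativeRing)
open import Data.Nat using (ℕ; zero; suc; _≤_)
open import Data.Integer as ℤ using (ℤ; +_; -[1+_])
open import Data.Fin using (Fin; zero; suc; toℕ; punchIn)
import Data.Fin as Fin
open import Data.Vec using (Vec; toList; lookup; _++_; replicate)
open import Data.List using (List; []; _∷_)
import Data.List as List
open import Function using (_∘_)

IsPartition : ∀ {n} → Vec ℕ n → Set
IsPartition {n} lam = ∀ (i j : Fin n) → i Fin.≤ j → lookup lam j ≤ lookup lam i

module WithRing {c ℓ} (R : CommutativeRing c ℓ) where
  open CommutativeRing R using (Carrier; _+_; _*_; -_; _-_; 0#; 1#)

  ∑ : ∀ {n} → (Fin n → Carrier) → Carrier
  ∑ {zero} f = 0#
  ∑ {suc n} f = f zero + ∑ (f ∘ suc)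

  -- complete homogeneous symmetric polynomial h_k in a list of variables,
  -- i.e. the coefficient of w^k in ∏_y 1/(1 - y w)
  hList : List Carrier → ℕ → Carrier
  hList [] zero = 1#
  hList [] (suc k) = 0#
  hList (y ∷ ys) zero = 1#
  hList (y ∷ ys) (suc k) = hList ys (suc k) + y * hList (y ∷ ys) k

  sign : ℕ → Carrier → Carrier
  sign zero a = a
  sign (suc zero) a = - a
  sign (suc (suc k)) a = sign k a

  det : ∀ {n} → (Fin n → Fin n → Carrier) → Carrier
  det {zero} M = 1#
  det {suc n} M =
    ∑ (λ j → sign (toℕ j) (M zero j * det (λ i k → M (suc i) (punchIn j k))))

  vars : ∀ {n m} → Vec Carrier n → Vec Carrier n → Vec Carrier m → List Carrier
  vars x xinv z = toList x List.++ toList xinv List.++ toList z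

  h : List Carrier → ℤ → Carrier
  h vs (+ k) = hList vs k
  h vs -[1+ k ] = 0#

  h′ : List Carrier → ℤ → Carrier
  h′ vs k = h vs k - h vs (k ℤ.- + 2)

  -- 0-based indices: i = toℕ i + 1, j = toℕ j + 1 in the paper's notation.
  -- universal orthogonal function:
  --   det (h_{λᵢ-i+j} - h_{λᵢ-i-j})_{i,j=1}^{N}
  o : ∀ {N} → List Carrier → (Fin N → ℕ) → Carrier
  o vs lam = det (λ i j →
      h vs (+ lam i ℤ.- + toℕ i ℤ.+ + toℕ j)
    - h vs (+ lam i ℤ.- + toℕ i ℤ.- + toℕ j ℤ.- + 2))

  δ>1 : ∀ {n} → Fin n → Carrier
  δ>1 zero = 0#
  δ>1 (suc _) = 1#

  krat : ∀ {n} → List Carrier → (Fin n → ℕ) → Carrier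
  krat vs lam = det (λ i j →
      h′ vs (+ lam i ℤ.- + toℕ i ℤ.+ + toℕ j)
    + δ>1 j * h′ vs (+ lam i ℤ.- + toℕ i ℤ.- + toℕ j))

{-# OPTIONS --safe #-}
-- The matrix of o_λ has size n + m and its last m rows have λᵢ = 0. There h vanishes at the
-- negative indices, so the bottom-left block is zero and the bottom-right block is unitriangular:
-- o_λ is the determinant of the top-left n × n block. Since h′ telescopes, column j of
-- Krattenthaler's matrix is column j minus column j - 2 of that block (the first two columns agree),
-- so the two determinants differ by column operations subtracting earlier columns.
module Submission where

open import Defs
open import Algebra.Bundles using (CommutativeRing)
open import Data.Nat as ℕ using (ℕ; zero; suc)
import Data.Nat.Properties as ℕ
open import Data.Fin as Fin using (Fin; zero; suc; toℕ; punchIn; punchOut; _↑ˡ_; _↑ʳ_; inject₁; fromℕ; fromℕ<)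
open import Data.Fin.Properties
  using (punchInᵢ≢i; punchIn-punchOut; punchIn-injective; suc-injective; toℕ-injective; toℕ-↑ˡ; toℕ-↑ʳ; toℕ<n; toℕ-fromℕ<; toℕ-inject₁)
open import Data.Fin.Permutation.Components using (transpose)
open import Data.Product using (∃; ∃₂; ∃-syntax; _×_; _,_)
open import Data.Sum using (_⊎_; inj₁; inj₂)
open import Function using (_∘_)
open import Relation.Binary.PropositionalEquality as ≡ using (_≡_; _≢_)
open import Relation.Nullary using (yes; no)
open import Relation.Nullary.Decidable using (dec-true; dec-false)
open import Data.Empty using (⊥-elim)
open import Data.List using (List; []; _∷_)
open import Data.Vec using (Vec; lookup; _++_; replicate)
import Data.Vec.Properties as Vec
open import Data.Integer as ℤ using (ℤ; +_; -[1+_])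
import Data.Integer.Properties as ℤ
open import Data.Integer.Tactic.RingSolver using (solve-∀)
import Algebra.Properties.AbelianGroup as AbelianGroupProperties
import Algebra.Properties.Ring as RingProperties
import Algebra.Properties.CommutativeSemigroup as CommutativeSemigroupProperties

module Determinant {c ℓ} (R : CommutativeRing c ℓ) where
  open CommutativeRing R hiding (zero)
  open WithRing R using (∑; sign; det)
  open RingProperties ring using (-0#≈0#; -‿involutive; -‿distribˡ-*)
  open CommutativeSemigroupProperties +-commutativeSemigroup using (interchange)
  open AbelianGroupProperties +-abelianGroup using (⁻¹-∙-comm; //-rightDividesˡ)
  open import Relation.Binary.Reasoning.Setoid setoid

  Matrix : ℕ → Set c
  Matrix n = Fin n → Fin n → Carrier

  x-0#≈x : ∀ x → x - 0# ≈ x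
  x-0#≈x x = trans (+-congˡ -0#≈0#) (+-identityʳ x)

  ∑-cong : ∀ {n} {f g : Fin n → Carrier} → (∀ j → f j ≈ g j) → ∑ f ≈ ∑ g
  ∑-cong {zero}  _   = refl
  ∑-cong {suc n} f≈g = +-cong (f≈g zero) (∑-cong (f≈g ∘ suc))

  ∑-zero : ∀ {n} {f : Fin n → Carrier} → (∀ j → f j ≈ 0#) → ∑ f ≈ 0#
  ∑-zero {zero}  _   = refl
  ∑-zero {suc n} f≈0 = trans (+-cong (f≈0 zero) (∑-zero (f≈0 ∘ suc))) (+-identityˡ 0#)

  ∑-distrib-+ : ∀ {n} (f g : Fin n → Carrier) → ∑ (λ j → f j + g j) ≈ ∑ f + ∑ g
  ∑-distrib-+ {zero}  f g = sym (+-identityˡ 0#)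
  ∑-distrib-+ {suc n} f g =
    trans (+-congˡ (∑-distrib-+ (f ∘ suc) (g ∘ suc))) (interchange _ _ _ _)

  ∑-distribʳ-* : ∀ {n} (f : Fin n → Carrier) a → ∑ (λ j → f j * a) ≈ ∑ f * a
  ∑-distribʳ-* {zero}  f a = sym (zeroˡ a)
  ∑-distribʳ-* {suc n} f a =
    trans (+-congˡ (∑-distribʳ-* (f ∘ suc) a)) (sym (distribʳ a (f zero) (∑ (f ∘ suc))))

  ∑-splitAt : ∀ n {m} (f : Fin (n ℕ.+ m) → Carrier) →
              ∑ f ≈ ∑ (λ j → f (j ↑ˡ m)) + ∑ (λ k → f (n ↑ʳ k))
  ∑-splitAt zero    f = sym (+-identityˡ _)
  ∑-splitAt (suc n) f = trans (+-congˡ (∑-splitAt n (f ∘ suc))) (sym (+-assoc _ _ _))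

  ∑-single : ∀ {n} (f : Fin n → Carrier) c → (∀ j → j ≢ c → f j ≈ 0#) → ∑ f ≈ f c
  ∑-single f zero    f≈0 =
    trans (+-congˡ (∑-zero (λ j → f≈0 (suc j) λ ()))) (+-identityʳ _)
  ∑-single f (suc c) f≈0 =
    trans (+-cong (f≈0 zero λ ()) (∑-single (f ∘ suc) c (λ j j≢c → f≈0 (suc j) (j≢c ∘ suc-injective))))
          (+-identityˡ _)

  ∑-pair : ∀ {n} (f : Fin n → Carrier) {c d} → c ≢ d →
           (∀ j → j ≢ c → j ≢ d → f j ≈ 0#) → ∑ f ≈ f c + f d
  ∑-pair f {zero}  {zero}  c≢d _   = ⊥-elim (c≢d ≡.refl)
  ∑-pair f {zero}  {suc d} _   f≈0 =
    +-congˡ (∑-single (f ∘ suc) d (λ j j≢d → f≈0 (suc j) (λ ()) (j≢d ∘ suc-injective)))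
  ∑-pair f {suc c} {zero}  _   f≈0 =
    trans (+-congˡ (∑-single (f ∘ suc) c (λ j j≢c → f≈0 (suc j) (j≢c ∘ suc-injective) (λ ()))))
          (+-comm _ _)
  ∑-pair f {suc c} {suc d} c≢d f≈0 =
    trans (+-cong (f≈0 zero (λ ()) (λ ()))
                  (∑-pair (f ∘ suc) (c≢d ∘ ≡.cong suc)
                          (λ j j≢c j≢d → f≈0 (suc j) (j≢c ∘ suc-injective) (j≢d ∘ suc-injective))))
          (+-identityˡ _)

  sign-cong : ∀ k {a b} → a ≈ b → sign k a ≈ sign k b
  sign-cong zero          a≈b = a≈b
  sign-cong (suc zero)    a≈b = -‿cong a≈b
  sign-cong (suc (suc k)) a≈b = sign-cong k a≈b

  sign-suc : ∀ k a → sign (suc k) a ≈ - sign k a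
  sign-suc zero          a = refl
  sign-suc (suc zero)    a = sym (-‿involutive a)
  sign-suc (suc (suc k)) a = sign-suc k a

  sign-+ : ∀ k a b → sign k (a + b) ≈ sign k a + sign k b
  sign-+ zero          a b = refl
  sign-+ (suc zero)    a b = sym (⁻¹-∙-comm a b)
  sign-+ (suc (suc k)) a b = sign-+ k a b

  sign-*ʳ : ∀ k a b → sign k (a * b) ≈ sign k a * b
  sign-*ʳ zero          a b = refl
  sign-*ʳ (suc zero)    a b = -‿distribˡ-* a b
  sign-*ʳ (suc (suc k)) a b = sign-*ʳ k a b

  sign-0 : ∀ k {a} → a ≈ 0# → sign k a ≈ 0#
  sign-0 zero          a≈0 = a≈0
  sign-0 (suc zero)    a≈0 = trans (-‿cong a≈0) -0#≈0#
  sign-0 (suc (suc k)) a≈0 = sign-0 k a≈0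

  minor : ∀ {n} → Matrix (suc n) → Fin (suc n) → Matrix n
  minor M j i k = M (suc i) (punchIn j k)

  laplaceTerm : ∀ {n} → Matrix (suc n) → Fin (suc n) → Carrier
  laplaceTerm M j = sign (toℕ j) (M zero j * det (minor M j))

  det-cong : ∀ {n} {M N : Matrix n} → (∀ i j → M i j ≈ N i j) → det M ≈ det N
  det-cong {zero}  _   = refl
  det-cong {suc n} M≈N = ∑-cong λ j →
    sign-cong (toℕ j) (*-cong (M≈N zero j) (det-cong λ i k → M≈N (suc i) (punchIn j k)))

  det-zero-column : ∀ {n} (M : Matrix n) c → (∀ i → M i c ≈ 0#) → det M ≈ 0#
  det-zero-column {suc n} M c M·c≈0 = ∑-zero λ j → sign-0 (toℕ j) (vanishes j)
    where
    vanishes : ∀ j → M zero j * det (minor M j) ≈ 0#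
    vanishes j with j Fin.≟ c
    ... | yes ≡.refl = trans (*-congʳ (M·c≈0 zero)) (zeroˡ _)
    ... | no j≢c     = trans (*-congˡ (det-zero-column (minor M j) (punchOut j≢c) λ i →
                         trans (reflexive (≡.cong (M (suc i)) (punchIn-punchOut j≢c))) (M·c≈0 (suc i))))
                         (zeroʳ _)

  det-linear-column : ∀ {n} (M N P : Matrix n) c →
    (∀ i → M i c ≈ N i c + P i c) →
    (∀ i j → j ≢ c → M i j ≈ N i j) → (∀ i j → j ≢ c → M i j ≈ P i j) →
    det M ≈ det N + det P
  det-linear-column {suc n} M N P c M·c≈ M≈N M≈P =
    trans (∑-cong additive) (∑-distrib-+ (laplaceTerm N) (laplaceTerm P))
    where
    additive : ∀ j → laplaceTerm M j ≈ laplaceTerm N j + laplaceTerm P j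
    additive j with j Fin.≟ c
    ... | yes ≡.refl = trans (sign-cong (toℕ j) (begin
          M zero j * det (minor M j)
            ≈⟨ *-congʳ (M·c≈ zero) ⟩
          (N zero j + P zero j) * det (minor M j)
            ≈⟨ distribʳ _ _ _ ⟩
          N zero j * det (minor M j) + P zero j * det (minor M j)
            ≈⟨ +-cong (*-congˡ (det-cong λ i k → M≈N (suc i) (punchIn j k) (punchInᵢ≢i j k)))
                      (*-congˡ (det-cong λ i k → M≈P (suc i) (punchIn j k) (punchInᵢ≢i j k))) ⟩
          N zero j * det (minor N j) + P zero j * det (minor P j) ∎))
          (sign-+ (toℕ j) _ _)
    ... | no j≢c = trans (sign-cong (toℕ j) (begin
          M zero j * det (minor M j)
            ≈⟨ *-congˡ (det-linear-column (minor M j) (minor N j) (minor P j) c′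
                 (λ i → ≡.subst (λ k → M (suc i) k ≈ N (suc i) k + P (suc i) k) (≡.sym c′↦c) (M·c≈ (suc i)))
                 (λ i k k≢c′ → M≈N (suc i) (punchIn j k) (k≢c′ ∘ moved k))
                 (λ i k k≢c′ → M≈P (suc i) (punchIn j k) (k≢c′ ∘ moved k))) ⟩
          M zero j * (det (minor N j) + det (minor P j))
            ≈⟨ distribˡ _ _ _ ⟩
          M zero j * det (minor N j) + M zero j * det (minor P j)
            ≈⟨ +-cong (*-congʳ (M≈N zero j j≢c)) (*-congʳ (M≈P zero j j≢c)) ⟩
          N zero j * det (minor N j) + P zero j * det (minor P j) ∎))
          (sign-+ (toℕ j) _ _)
      where
      c′ = punchOut j≢c
      c′↦c : punchIn j c′ ≡ c
      c′↦c = punchIn-punchOut j≢c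
      moved : ∀ k → punchIn j k ≡ c → k ≡ c′
      moved k p = punchIn-injective j k c′ (≡.trans p (≡.sym c′↦c))

  data Adjacent : ∀ {n} → Fin n → Fin n → Set where
    zero-one : ∀ {n} → Adjacent {suc (suc n)} zero (suc zero)
    suc-suc  : ∀ {n} {c d : Fin n} → Adjacent c d → Adjacent (suc c) (suc d)

  Adjacent⇒toℕ : ∀ {n} {c d : Fin n} → Adjacent c d → toℕ d ≡ suc (toℕ c)
  Adjacent⇒toℕ zero-one    = ≡.refl
  Adjacent⇒toℕ (suc-suc a) = ≡.cong suc (Adjacent⇒toℕ a)

  Adjacent⇒≢ : ∀ {n} {c d : Fin n} → Adjacent c d → c ≢ d
  Adjacent⇒≢ zero-one    ()
  Adjacent⇒≢ (suc-suc a) c≡d = Adjacent⇒≢ a (suc-injective c≡d)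

  predecessor : ∀ {n} (d : Fin n) s → toℕ d ≡ suc s → ∃ λ c → Adjacent c d × toℕ c ≡ s
  predecessor (suc zero)    zero    _   = zero , zero-one , ≡.refl
  predecessor (suc (suc d)) (suc s) eq with predecessor (suc d) s (ℕ.suc-injective eq)
  ... | c , a , toℕc≡s = suc c , suc-suc a , ≡.cong suc toℕc≡s

  -- The minors at adjacent columns c and d differ only in one column, which is c in one and d in the other.
  punchIn-Adjacent : ∀ {n} {c d : Fin (suc n)} → Adjacent c d → ∀ k →
    (punchIn d k ≡ c × punchIn c k ≡ d) ⊎
    (punchIn d k ≡ punchIn c k × punchIn c k ≢ c × punchIn c k ≢ d)
  punchIn-Adjacent zero-one    zero    = inj₁ (≡.refl , ≡.refl)
  punchIn-Adjacent zero-one    (suc k) = inj₂ (≡.refl , (λ ()) , (λ ()))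
  punchIn-Adjacent (suc-suc a) zero    = inj₂ (≡.refl , (λ ()) , (λ ()))
  punchIn-Adjacent (suc-suc a) (suc k) with punchIn-Adjacent a k
  ... | inj₁ (p , q)       = inj₁ (≡.cong suc p , ≡.cong suc q)
  ... | inj₂ (p , q₁ , q₂) = inj₂ (≡.cong suc p , q₁ ∘ suc-injective , q₂ ∘ suc-injective)

  Adjacent-punchOut : ∀ {n} {c d : Fin (suc n)} → Adjacent c d → ∀ j → j ≢ c → j ≢ d →
    ∃₂ λ c′ d′ → Adjacent c′ d′ × punchIn j c′ ≡ c × punchIn j d′ ≡ d
  Adjacent-punchOut zero-one    zero          j≢c _   = ⊥-elim (j≢c ≡.refl)
  Adjacent-punchOut zero-one    (suc zero)    _   j≢d = ⊥-elim (j≢d ≡.refl)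
  Adjacent-punchOut {suc (suc n)} zero-one (suc (suc j)) _ _ = zero , suc zero , zero-one , ≡.refl , ≡.refl
  Adjacent-punchOut {suc n} (suc-suc a) zero _ _ = _ , _ , a , ≡.refl , ≡.refl
  Adjacent-punchOut {suc n} (suc-suc a) (suc j) j≢c j≢d
    with Adjacent-punchOut a j (j≢c ∘ ≡.cong suc) (j≢d ∘ ≡.cong suc)
  ... | c′ , d′ , a′ , p , q = suc c′ , suc d′ , suc-suc a′ , ≡.cong suc p , ≡.cong suc q

  sign-Adjacent : ∀ {n} {c d : Fin n} → Adjacent c d → ∀ a → sign (toℕ d) a ≈ - sign (toℕ c) a
  sign-Adjacent {c = c} adj a rewrite Adjacent⇒toℕ adj = sign-suc (toℕ c) a

  record ColumnSwap {n} (c d : Fin n) (M N : Matrix n) : Set ℓ where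
    field
      at-left   : ∀ i → N i c ≈ M i d
      at-right  : ∀ i → N i d ≈ M i c
      elsewhere : ∀ i j → j ≢ c → j ≢ d → N i j ≈ M i j

  module _ {n} {M N : Matrix (suc n)} {c d} (adj : Adjacent c d) (swap : ColumnSwap c d M N) where
    open ColumnSwap swap

    minor-ColumnSwap-left : ∀ i k → minor N c i k ≈ minor M d i k
    minor-ColumnSwap-left i k with punchIn-Adjacent adj k
    ... | inj₁ (p , q) rewrite p | q = at-right (suc i)
    ... | inj₂ (p , q₁ , q₂) rewrite p = elsewhere (suc i) _ q₁ q₂

    minor-ColumnSwap-right : ∀ i k → minor N d i k ≈ minor M c i k
    minor-ColumnSwap-right i k with punchIn-Adjacent adj k
    ... | inj₁ (p , q) rewrite p | q = at-left (suc i)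
    ... | inj₂ (p , q₁ , q₂) rewrite p = elsewhere (suc i) _ q₁ q₂

    ColumnSwap-minor : ∀ {j c′ d′} → punchIn j c′ ≡ c → punchIn j d′ ≡ d →
                       ColumnSwap c′ d′ (minor M j) (minor N j)
    ColumnSwap-minor {j} {c′} {d′} c′↦c d′↦d = record
      { at-left   = λ i → ≡.subst₂ (λ x y → N (suc i) x ≈ M (suc i) y) (≡.sym c′↦c) (≡.sym d′↦d) (at-left (suc i))
      ; at-right  = λ i → ≡.subst₂ (λ x y → N (suc i) x ≈ M (suc i) y) (≡.sym d′↦d) (≡.sym c′↦c) (at-right (suc i))
      ; elsewhere = λ i k k≢c′ k≢d′ → elsewhere (suc i) (punchIn j k) (k≢c′ ∘ moved c′↦c) (k≢d′ ∘ moved d′↦d)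
      }
      where
      moved : ∀ {x y k} → punchIn j x ≡ y → punchIn j k ≡ y → k ≡ x
      moved {x} {k = k} x↦y k↦y = punchIn-injective j k x (≡.trans k↦y (≡.sym x↦y))

  det-Adjacent-equal-columns : ∀ {n} (M : Matrix n) {c d} → Adjacent c d →
                               (∀ i → M i c ≈ M i d) → det M ≈ 0#
  det-Adjacent-equal-columns {suc n} M {c} {d} adj M·c≈M·d = begin
    det M                               ≈⟨ ∑-pair (laplaceTerm M) (Adjacent⇒≢ adj) vanishes ⟩
    laplaceTerm M c + laplaceTerm M d   ≈⟨ +-congˡ (trans (sign-Adjacent adj _) (-‿cong (sign-cong (toℕ c)
                                             (*-cong (sym (M·c≈M·d zero)) (det-cong λ i k → sym (minor-ColumnSwap-left adj self i k)))))) ⟩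
    laplaceTerm M c - laplaceTerm M c   ≈⟨ -‿inverseʳ _ ⟩
    0#                                  ∎
    where
    self : ColumnSwap c d M M
    self = record { at-left = M·c≈M·d ; at-right = sym ∘ M·c≈M·d ; elsewhere = λ _ _ _ _ → refl }
    vanishes : ∀ j → j ≢ c → j ≢ d → laplaceTerm M j ≈ 0#
    vanishes j j≢c j≢d with Adjacent-punchOut adj j j≢c j≢d
    ... | c′ , d′ , adj′ , c′↦c , d′↦d = sign-0 (toℕ j) (trans (*-congˡ
          (det-Adjacent-equal-columns (minor M j) adj′
            (ColumnSwap.at-left (ColumnSwap-minor adj self c′↦c d′↦d))))
          (zeroʳ _))

  det-swap-Adjacent-columns : ∀ {n} (M N : Matrix n) {c d} → Adjacent c d →
                              ColumnSwap c d M N → det M + det N ≈ 0#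
  det-swap-Adjacent-columns {suc n} M N {c} {d} adj swap = begin
    det M + det N
      ≈⟨ ∑-distrib-+ (laplaceTerm M) (laplaceTerm N) ⟨
    ∑ (λ j → laplaceTerm M j + laplaceTerm N j)
      ≈⟨ ∑-pair _ (Adjacent⇒≢ adj) vanishes ⟩
    (laplaceTerm M c + laplaceTerm N c) + (laplaceTerm M d + laplaceTerm N d)
      ≈⟨ +-cong (+-congˡ N-at-left) (+-congˡ N-at-right) ⟩
    (laplaceTerm M c - laplaceTerm M d) + (laplaceTerm M d - laplaceTerm M c)
      ≈⟨ +-congˡ (+-comm _ _) ⟩
    (laplaceTerm M c - laplaceTerm M d) + (- laplaceTerm M c + laplaceTerm M d)
      ≈⟨ interchange _ _ _ _ ⟩
    (laplaceTerm M c - laplaceTerm M c) + (- laplaceTerm M d + laplaceTerm M d)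
      ≈⟨ +-cong (-‿inverseʳ _) (-‿inverseˡ _) ⟩
    0# + 0#
      ≈⟨ +-identityˡ 0# ⟩
    0# ∎
    where
    open ColumnSwap swap
    N-at-left : laplaceTerm N c ≈ - laplaceTerm M d
    N-at-left = trans (sign-cong (toℕ c) (*-cong (at-left zero) (det-cong (minor-ColumnSwap-left adj swap))))
                  (trans (sym (-‿involutive _)) (-‿cong (sym (sign-Adjacent adj _))))
    N-at-right : laplaceTerm N d ≈ - laplaceTerm M c
    N-at-right = trans (sign-Adjacent adj _)
                   (-‿cong (sign-cong (toℕ c) (*-cong (at-right zero) (det-cong (minor-ColumnSwap-right adj swap)))))
    vanishes : ∀ j → j ≢ c → j ≢ d → laplaceTerm M j + laplaceTerm N j ≈ 0#
    vanishes j j≢c j≢d with Adjacent-punchOut adj j j≢c j≢d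
    ... | c′ , d′ , adj′ , c′↦c , d′↦d = trans (sym (sign-+ (toℕ j) _ _)) (sign-0 (toℕ j) (begin
          M zero j * det (minor M j) + N zero j * det (minor N j)
            ≈⟨ +-congˡ (*-congʳ (elsewhere zero j j≢c j≢d)) ⟩
          M zero j * det (minor M j) + M zero j * det (minor N j)
            ≈⟨ distribˡ _ _ _ ⟨
          M zero j * (det (minor M j) + det (minor N j))
            ≈⟨ *-congˡ (det-swap-Adjacent-columns (minor M j) (minor N j) adj′ (ColumnSwap-minor adj swap c′↦c d′↦d)) ⟩
          M zero j * 0#
            ≈⟨ zeroʳ _ ⟩
          0# ∎))

  transpose-left : ∀ {n} (c d : Fin n) → transpose c d c ≡ d
  transpose-left c d rewrite dec-true (c Fin.≟ c) ≡.refl = ≡.refl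

  transpose-right : ∀ {n} {c d : Fin n} → c ≢ d → transpose c d d ≡ c
  transpose-right {c = c} {d} c≢d
    rewrite dec-false (d Fin.≟ c) (c≢d ∘ ≡.sym) | dec-true (d Fin.≟ d) ≡.refl = ≡.refl

  transpose-other : ∀ {n} {c d k : Fin n} → k ≢ c → k ≢ d → transpose c d k ≡ k
  transpose-other {c = c} {d} {k} k≢c k≢d
    rewrite dec-false (k Fin.≟ c) k≢c | dec-false (k Fin.≟ d) k≢d = ≡.refl

  swapColumns-ColumnSwap : ∀ {n} (M : Matrix n) {c d} → c ≢ d →
                           ColumnSwap c d M (λ i j → M i (transpose c d j))
  swapColumns-ColumnSwap M {c} {d} c≢d = record
    { at-left   = λ i → reflexive (≡.cong (M i) (transpose-left c d))
    ; at-right  = λ i → reflexive (≡.cong (M i) (transpose-right c≢d))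
    ; elsewhere = λ i j j≢c j≢d → reflexive (≡.cong (M i) (transpose-other j≢c j≢d))
    }

  -- Induction on the distance k + 1 between the columns: swapping d with its left neighbour
  -- brings the repeated column one step closer.
  det-equal-columns-at-distance : ∀ k {n} (M : Matrix n) {c d} → toℕ d ≡ suc (toℕ c ℕ.+ k) →
                                  (∀ i → M i c ≈ M i d) → det M ≈ 0#
  det-equal-columns-at-distance k M {c} {d} d-c≡1+k M·c≈M·d
    with predecessor d (toℕ c ℕ.+ k) d-c≡1+k
  det-equal-columns-at-distance zero M {c} {d} _ M·c≈M·d | d′ , adj , d′-c≡0 =
    det-Adjacent-equal-columns M (≡.subst (λ x → Adjacent x d) d′≡c adj) M·c≈M·d
    where
    d′≡c : d′ ≡ c
    d′≡c = toℕ-injective (≡.trans d′-c≡0 (ℕ.+-identityʳ (toℕ c)))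
  det-equal-columns-at-distance (suc k) M {c} {d} d-c≡2+k M·c≈M·d | d′ , adj , d′-c≡1+k =
    begin
      det M                   ≈⟨ +-identityʳ _ ⟨
      det M + 0#              ≈⟨ +-congˡ (det-equal-columns-at-distance k N (≡.trans d′-c≡1+k (ℕ.+-suc (toℕ c) k)) N·c≈N·d′) ⟨
      det M + det N           ≈⟨ det-swap-Adjacent-columns M N adj swap ⟩
      0#                      ∎
    where
    N : Matrix _
    N i j = M i (transpose d′ d j)
    swap : ColumnSwap d′ d M N
    swap = swapColumns-ColumnSwap M (Adjacent⇒≢ adj)
    c<d′ : toℕ c ℕ.< toℕ d′
    c<d′ = ≡.subst (toℕ c ℕ.<_) (≡.sym d′-c≡1+k) (ℕ.m<m+n (toℕ c) ℕ.z<s)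
    c≢d′ : c ≢ d′
    c≢d′ c≡d′ = ℕ.<-irrefl (≡.cong toℕ c≡d′) c<d′
    c≢d : c ≢ d
    c≢d c≡d = ℕ.<-irrefl (≡.cong toℕ c≡d) (ℕ.<-trans c<d′ (ℕ.≤-reflexive (≡.sym (Adjacent⇒toℕ adj))))
    N·c≈N·d′ : ∀ i → N i c ≈ N i d′
    N·c≈N·d′ i = trans (ColumnSwap.elsewhere swap i c c≢d′ c≢d)
                   (trans (M·c≈M·d i) (sym (ColumnSwap.at-left swap i)))

  det-equal-columns : ∀ {n} (M : Matrix n) {c d} → toℕ c ℕ.< toℕ d →
                      (∀ i → M i c ≈ M i d) → det M ≈ 0#
  det-equal-columns M {c} {d} c<d =
    det-equal-columns-at-distance (toℕ d ℕ.∸ suc (toℕ c)) M (≡.sym (ℕ.m+[n∸m]≡n c<d))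

  replaceColumn : ∀ {n} → Matrix n → Fin n → (Fin n → Carrier) → Matrix n
  replaceColumn M c v i j with j Fin.≟ c
  ... | yes _ = v i
  ... | no  _ = M i j

  replaceColumn-at : ∀ {n} (M : Matrix n) c v i → replaceColumn M c v i c ≈ v i
  replaceColumn-at M c v i with c Fin.≟ c
  ... | yes _   = refl
  ... | no  c≢c = ⊥-elim (c≢c ≡.refl)

  replaceColumn-other : ∀ {n} (M : Matrix n) c v i j → j ≢ c → replaceColumn M c v i j ≈ M i j
  replaceColumn-other M c v i j j≢c with j Fin.≟ c
  ... | yes j≡c = ⊥-elim (j≢c j≡c)
  ... | no  _   = refl

  keepFrom : ℕ → ℕ → Carrier → Carrier
  keepFrom zero    _       x = x
  keepFrom (suc t) zero    _ = 0#
  keepFrom (suc t) (suc u) x = keepFrom t u x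

  keepFrom-self : ∀ t x → keepFrom t t x ≡ x
  keepFrom-self zero    x = ≡.refl
  keepFrom-self (suc t) x = keepFrom-self t x

  keepFrom-< : ∀ {t u} x → u ℕ.< t → keepFrom t u x ≡ 0#
  keepFrom-< {suc t} {zero}  x _         = ≡.refl
  keepFrom-< {suc t} {suc u} x (ℕ.s≤s u<t) = keepFrom-< x u<t

  keepFrom-≢ : ∀ {t u} x → u ≢ t → keepFrom t u x ≡ keepFrom (suc t) u x
  keepFrom-≢ {zero}  {zero}  x u≢t = ⊥-elim (u≢t ≡.refl)
  keepFrom-≢ {zero}  {suc u} x _   = ≡.refl
  keepFrom-≢ {suc t} {zero}  x _   = ≡.refl
  keepFrom-≢ {suc t} {suc u} x u≢t = keepFrom-≢ x (u≢t ∘ ≡.cong suc)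

  ZeroOrEarlierColumn : ∀ {n} → Matrix n → Matrix n → Fin n → Set ℓ
  ZeroOrEarlierColumn M G j = (∀ i → G i j ≈ 0#) ⊎ ∃[ c ] (toℕ c ℕ.< toℕ j × ∀ i → G i j ≈ M i c)

  -- Columns are restored from left to right: at stage t the columns before t are already those of M,
  -- so the column of M that G subtracts from column t is still present.
  det-subtract-earlier-columns : ∀ {n} (M G : Matrix n) → (∀ j → ZeroOrEarlierColumn M G j) →
                                 det (λ i j → M i j - G i j) ≈ det M
  det-subtract-earlier-columns {n} M G earlier =
    trans (restore n ℕ.≤-refl) (det-cong λ i j →
      trans (+-congˡ (-‿cong (reflexive (keepFrom-< (G i j) (toℕ<n j))))) (x-0#≈x (M i j)))
    where
    stage : ℕ → Matrix n
    stage t i j = M i j - keepFrom t (toℕ j) (G i j)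

    restoreColumn : ∀ c → det (stage (toℕ c)) ≈ det (stage (suc (toℕ c)))
    restoreColumn c = sym (begin
      det (stage (suc t))     ≈⟨ det-linear-column (stage (suc t)) (stage t) P c at-c unchanged
                                   (λ i j j≢c → sym (replaceColumn-other _ c _ i j j≢c)) ⟩
      det (stage t) + det P   ≈⟨ +-congˡ det-P≈0 ⟩
      det (stage t) + 0#      ≈⟨ +-identityʳ _ ⟩
      det (stage t)           ∎)
      where
      t = toℕ c
      P : Matrix n
      P = replaceColumn (stage (suc t)) c (λ i → G i c)
      restored : ∀ i j → toℕ j ℕ.< suc t → stage (suc t) i j ≈ M i j
      restored i j j<1+t = trans (+-congˡ (-‿cong (reflexive (keepFrom-< (G i j) j<1+t)))) (x-0#≈x (M i j))
      at-c : ∀ i → stage (suc t) i c ≈ stage t i c + P i c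
      at-c i = begin
        stage (suc t) i c     ≈⟨ restored i c ℕ.≤-refl ⟩
        M i c                 ≈⟨ //-rightDividesˡ (G i c) (M i c) ⟨
        M i c - G i c + G i c ≈⟨ +-cong (+-congˡ (-‿cong (reflexive (keepFrom-self t (G i c))))) (replaceColumn-at _ c _ i) ⟨
        stage t i c + P i c   ∎
      unchanged : ∀ i j → j ≢ c → stage (suc t) i j ≈ stage t i j
      unchanged i j j≢c = +-congˡ (-‿cong (reflexive (≡.sym (keepFrom-≢ (G i j) (j≢c ∘ toℕ-injective)))))
      det-P≈0 : det P ≈ 0#
      det-P≈0 with earlier c
      ... | inj₁ G·c≈0 = det-zero-column P c λ i → trans (replaceColumn-at _ c _ i) (G·c≈0 i)
      ... | inj₂ (c′ , c′<c , G·c≈M·c′) = det-equal-columns P c′<c λ i → begin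
            P i c′             ≈⟨ replaceColumn-other _ c _ i c′ (λ c′≡c → ℕ.<-irrefl (≡.cong toℕ c′≡c) c′<c) ⟩
            stage (suc t) i c′ ≈⟨ restored i c′ (ℕ.m<n⇒m<1+n c′<c) ⟩
            M i c′             ≈⟨ G·c≈M·c′ i ⟨
            G i c              ≈⟨ replaceColumn-at _ c _ i ⟨
            P i c              ∎

    restore : ∀ t → t ℕ.≤ n → det (stage 0) ≈ det (stage t)
    restore zero    _   = refl
    restore (suc t) t<n = trans (restore t (ℕ.<⇒≤ t<n))
      (≡.subst (λ u → det (stage u) ≈ det (stage (suc u))) (toℕ-fromℕ< t<n) (restoreColumn (fromℕ< t<n)))

  topLeft : ∀ n m → Matrix (n ℕ.+ m) → Matrix n
  topLeft n m M i j = M (i ↑ˡ m) (j ↑ˡ m)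

  bottomRight : ∀ n m → Matrix (n ℕ.+ m) → Matrix m
  bottomRight n m M k l = M (n ↑ʳ k) (n ↑ʳ l)

  punchIn-↑ˡ : ∀ {n} m (j : Fin (suc n)) k → punchIn (j ↑ˡ m) (k ↑ˡ m) ≡ punchIn j k ↑ˡ m
  punchIn-↑ˡ m zero    k       = ≡.refl
  punchIn-↑ˡ m (suc j) zero    = ≡.refl
  punchIn-↑ˡ m (suc j) (suc k) = ≡.cong suc (punchIn-↑ˡ m j k)

  punchIn-↑ˡ-↑ʳ : ∀ n {m} (j : Fin (suc n)) (l : Fin m) → punchIn (j ↑ˡ m) (n ↑ʳ l) ≡ suc n ↑ʳ l
  punchIn-↑ˡ-↑ʳ n       zero    l = ≡.refl
  punchIn-↑ˡ-↑ʳ (suc n) (suc j) l = ≡.cong suc (punchIn-↑ˡ-↑ʳ n j l)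

  punchIn-↑ʳ-↑ˡ : ∀ n {m} (l : Fin m) (j : Fin n) → punchIn (suc n ↑ʳ l) (j ↑ˡ m) ≡ inject₁ j ↑ˡ m
  punchIn-↑ʳ-↑ˡ (suc n) l zero    = ≡.refl
  punchIn-↑ʳ-↑ˡ (suc n) l (suc j) = ≡.cong suc (punchIn-↑ʳ-↑ˡ n l j)

  least : ∀ {m} → Fin m → Fin m
  least zero    = zero
  least (suc _) = zero

  punchIn-↑ʳ-least : ∀ n {m} (l : Fin m) → punchIn (suc n ↑ʳ l) (n ↑ʳ least l) ≡ fromℕ n ↑ˡ m
  punchIn-↑ʳ-least zero    zero    = ≡.refl
  punchIn-↑ʳ-least zero    (suc l) = ≡.refl
  punchIn-↑ʳ-least (suc n) l       = ≡.cong suc (punchIn-↑ʳ-least n l)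

  det-block-triangular : ∀ n m (M : Matrix (n ℕ.+ m)) →
    (∀ k j → M (n ↑ʳ k) (j ↑ˡ m) ≈ 0#) →
    det M ≈ det (topLeft n m M) * det (bottomRight n m M)
  det-block-triangular zero    m M _   = sym (*-identityˡ _)
  det-block-triangular (suc n) m M bottomLeft≈0 = begin
    det M
      ≈⟨ ∑-splitAt (suc n) (laplaceTerm M) ⟩
    ∑ (λ j → laplaceTerm M (j ↑ˡ m)) + ∑ (λ l → laplaceTerm M (suc n ↑ʳ l))
      ≈⟨ +-cong (∑-cong left-term) (∑-zero right-term) ⟩
    ∑ (λ j → laplaceTerm (topLeft (suc n) m M) j * det (bottomRight (suc n) m M)) + 0#
      ≈⟨ +-identityʳ _ ⟩
    ∑ (λ j → laplaceTerm (topLeft (suc n) m M) j * det (bottomRight (suc n) m M))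
      ≈⟨ ∑-distribʳ-* (laplaceTerm (topLeft (suc n) m M)) _ ⟩
    det (topLeft (suc n) m M) * det (bottomRight (suc n) m M) ∎
    where
    TL = topLeft (suc n) m M
    BR = bottomRight (suc n) m M

    left-term : ∀ j → laplaceTerm M (j ↑ˡ m) ≈ laplaceTerm TL j * det BR
    left-term j = begin
      sign (toℕ (j ↑ˡ m)) (M zero (j ↑ˡ m) * det (minor M (j ↑ˡ m)))
        ≡⟨ ≡.cong (λ s → sign s (M zero (j ↑ˡ m) * det (minor M (j ↑ˡ m)))) (toℕ-↑ˡ j m) ⟩
      sign (toℕ j) (TL zero j * det (minor M (j ↑ˡ m)))
        ≈⟨ sign-cong (toℕ j) (*-congˡ det-minor) ⟩
      sign (toℕ j) (TL zero j * (det (minor TL j) * det BR))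
        ≈⟨ sign-cong (toℕ j) (*-assoc _ _ _) ⟨
      sign (toℕ j) (TL zero j * det (minor TL j) * det BR)
        ≈⟨ sign-*ʳ (toℕ j) _ _ ⟩
      laplaceTerm TL j * det BR ∎
      where
      det-minor : det (minor M (j ↑ˡ m)) ≈ det (minor TL j) * det BR
      det-minor = trans
        (det-block-triangular n m (minor M (j ↑ˡ m)) λ k j′ →
          trans (reflexive (≡.cong (M (suc n ↑ʳ k)) (punchIn-↑ˡ m j j′))) (bottomLeft≈0 k _))
        (*-cong (det-cong λ i k → reflexive (≡.cong (M (suc (i ↑ˡ m))) (punchIn-↑ˡ m j k)))
                (det-cong λ k l → reflexive (≡.cong (M (suc n ↑ʳ k)) (punchIn-↑ˡ-↑ʳ n j l))))

    -- Deleting a column of the right block leaves m rows supported on m - 1 columns.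
    right-term : ∀ l → laplaceTerm M (suc n ↑ʳ l) ≈ 0#
    right-term l = sign-0 (toℕ (suc n ↑ʳ l)) (trans (*-congˡ det-N≈0) (zeroʳ _))
      where
      N = minor M (suc n ↑ʳ l)
      det-N≈0 : det N ≈ 0#
      det-N≈0 = begin
        det N
          ≈⟨ det-block-triangular n m N (λ k j →
               trans (reflexive (≡.cong (M (suc n ↑ʳ k)) (punchIn-↑ʳ-↑ˡ n l j))) (bottomLeft≈0 k _)) ⟩
        det (topLeft n m N) * det (bottomRight n m N)
          ≈⟨ *-congˡ (det-zero-column (bottomRight n m N) (least l) λ k →
               trans (reflexive (≡.cong (M (suc n ↑ʳ k)) (punchIn-↑ʳ-least n l))) (bottomLeft≈0 k _)) ⟩
        det (topLeft n m N) * 0#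
          ≈⟨ zeroʳ _ ⟩
        0# ∎

  det-upper-unitriangular : ∀ {m} (M : Matrix m) →
    (∀ k l → toℕ l ℕ.< toℕ k → M k l ≈ 0#) → (∀ k → M k k ≈ 1#) → det M ≈ 1#
  det-upper-unitriangular {zero}  M _ _ = refl
  det-upper-unitriangular {suc m} M below≈0 diagonal≈1 = begin
    det M
      ≈⟨ det-block-triangular 1 m M (λ k → λ { zero → below≈0 (suc k) zero ℕ.z<s }) ⟩
    det (topLeft 1 m M) * det (bottomRight 1 m M)
      ≈⟨ *-cong (trans (+-identityʳ _) (trans (*-identityʳ _) (diagonal≈1 zero)))
                (det-upper-unitriangular (bottomRight 1 m M) (λ k l l<k → below≈0 (suc k) (suc l) (ℕ.s<s l<k))
                                         (diagonal≈1 ∘ suc)) ⟩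
    1# * 1#
      ≈⟨ *-identityˡ 1# ⟩
    1# ∎

module Orthogonal {c ℓ} (R : CommutativeRing c ℓ) (vs : List (CommutativeRing.Carrier R)) where
  open CommutativeRing R hiding (zero)
  open WithRing R using (hList; h; h′; δ>1; det)
  open Determinant R
  open RingProperties ring using (-‿involutive)
  open AbelianGroupProperties +-abelianGroup using (⁻¹-∙-comm)
  open CommutativeSemigroupProperties +-commutativeSemigroup using (interchange)
  open import Relation.Binary.Reasoning.Setoid setoid

  [x-y]+[u-w]≈[x-w]-[y-u] : ∀ x y u w → (x - y) + (u - w) ≈ (x - w) - (y - u)
  [x-y]+[u-w]≈[x-w]-[y-u] x y u w = begin
    (x - y) + (u - w)       ≈⟨ interchange _ _ _ _ ⟩
    (x + u) + (- y + - w)   ≈⟨ +-congˡ (+-comm _ _) ⟩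
    (x + u) + (- w + - y)   ≈⟨ interchange _ _ _ _ ⟩
    (x - w) + (u - y)       ≈⟨ +-congˡ (+-comm u (- y)) ⟩
    (x - w) + (- y + u)     ≈⟨ +-congˡ (+-congˡ (-‿involutive u)) ⟨
    (x - w) + (- y + - - u) ≈⟨ +-congˡ (⁻¹-∙-comm y (- u)) ⟩
    (x - w) - (y - u)       ∎

  [x-y]+[y-w]≈x-w : ∀ x y w → (x - y) + (y - w) ≈ x - w
  [x-y]+[y-w]≈x-w x y w = trans ([x-y]+[u-w]≈[x-w]-[y-u] x y y w) (trans (+-congˡ (-‿cong (-‿inverseʳ y))) (x-0#≈x (x - w)))

  hList-zero : ∀ ws → hList ws 0 ≡ 1#
  hList-zero []      = ≡.refl
  hList-zero (_ ∷ _) = ≡.refl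

  h-≡ : ∀ {k l} → k ≡ l → h vs k ≈ h vs l
  h-≡ = reflexive ∘ ≡.cong (h vs)

  h-⊖-< : ∀ {p q} → q ℕ.< p → h vs (q ℤ.⊖ p) ≈ 0#
  h-⊖-< {suc p} {zero}  _           = refl
  h-⊖-< {suc p} {suc q} (ℕ.s≤s q<p) = trans (h-≡ (ℤ.[1+m]⊖[1+n]≡m⊖n q p)) (h-⊖-< q<p)

  h-⊖-self : ∀ q → h vs (q ℤ.⊖ q) ≈ 1#
  h-⊖-self q = trans (h-≡ (ℤ.n⊖n≡0 q)) (reflexive (hList-zero vs))

  orthogonalEntry : ℤ → ℕ → Carrier
  orthogonalEntry a q = h vs (a ℤ.+ + q) - h vs (a ℤ.- + q ℤ.- + 2)

  intermediateEntry : ∀ {n} → ℤ → Fin n → Carrier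
  intermediateEntry a j = h′ vs (a ℤ.+ + toℕ j) + δ>1 j * h′ vs (a ℤ.- + toℕ j)

  rowOffset : ∀ {N} → (Fin N → ℕ) → Fin N → ℤ
  rowOffset lam i = + lam i ℤ.- + toℕ i

  orthogonalMatrix : ∀ {N} → (Fin N → ℕ) → Matrix N
  orthogonalMatrix lam i j = orthogonalEntry (rowOffset lam i) (toℕ j)

  intermediateMatrix : ∀ {N} → (Fin N → ℕ) → Matrix N
  intermediateMatrix lam i j = intermediateEntry (rowOffset lam i) j

  orthogonalEntry-zeroRow : ∀ p q → orthogonalEntry (+ 0 ℤ.- + p) q ≈ h vs (q ℤ.⊖ p)
  orthogonalEntry-zeroRow p q = begin
    h vs (+ 0 ℤ.- + p ℤ.+ + q) - h vs (+ 0 ℤ.- + p ℤ.- + q ℤ.- + 2)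
      ≈⟨ +-cong (h-≡ first) (-‿cong (h-≡ second)) ⟩
    h vs (q ℤ.⊖ p) - 0#
      ≈⟨ x-0#≈x _ ⟩
    h vs (q ℤ.⊖ p) ∎
    where
    first : + 0 ℤ.- + p ℤ.+ + q ≡ q ℤ.⊖ p
    first = ≡.trans (≡.cong (ℤ._+ + q) (ℤ.+-identityˡ (ℤ.- + p))) (ℤ.-m+n≡n⊖m p q)
    shape : ∀ P Q → + 0 ℤ.- P ℤ.- Q ℤ.- + 2 ≡ ℤ.- (+ 2 ℤ.+ (P ℤ.+ Q))
    shape = solve-∀
    second : + 0 ℤ.- + p ℤ.- + q ℤ.- + 2 ≡ -[1+ suc (p ℕ.+ q) ]
    second = shape (+ p) (+ q)

  orthogonalEntry-below : ∀ {p q} → q ℕ.< p → orthogonalEntry (+ 0 ℤ.- + p) q ≈ 0#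
  orthogonalEntry-below {p} {q} q<p = trans (orthogonalEntry-zeroRow p q) (h-⊖-< q<p)

  orthogonalEntry-diagonal : ∀ p → orthogonalEntry (+ 0 ℤ.- + p) p ≈ 1#
  orthogonalEntry-diagonal p = trans (orthogonalEntry-zeroRow p p) (h-⊖-self p)

  twoColumnsLeft : ∀ {n} → Matrix n → Matrix n
  twoColumnsLeft M i zero          = 0#
  twoColumnsLeft M i (suc zero)    = 0#
  twoColumnsLeft M i (suc (suc j)) = M i (inject₁ (inject₁ j))

  twoColumnsLeft-earlier : ∀ {n} (M : Matrix n) j → ZeroOrEarlierColumn M (twoColumnsLeft M) j
  twoColumnsLeft-earlier M zero          = inj₁ λ _ → refl
  twoColumnsLeft-earlier M (suc zero)    = inj₁ λ _ → refl
  twoColumnsLeft-earlier M (suc (suc j)) = inj₂ (inject₁ (inject₁ j) , earlier , λ _ → refl)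
    where
    earlier : toℕ (inject₁ (inject₁ j)) ℕ.< suc (suc (toℕ j))
    earlier rewrite toℕ-inject₁ (inject₁ j) | toℕ-inject₁ j = ℕ.m<n+m (toℕ j) ℕ.z<s

  intermediate≈orthogonal-twoColumnsLeft : ∀ {n} (lam : Fin n → ℕ) i j →
    intermediateMatrix lam i j ≈ orthogonalMatrix lam i j - twoColumnsLeft (orthogonalMatrix lam) i j
  intermediate≈orthogonal-twoColumnsLeft lam i zero = begin
    h′ vs (a ℤ.+ + 0) + 0# * h′ vs (a ℤ.- + 0)        ≈⟨ +-congˡ (zeroˡ _) ⟩
    h′ vs (a ℤ.+ + 0) + 0#                              ≈⟨ +-identityʳ _ ⟩
    h vs (a ℤ.+ + 0) - h vs (a ℤ.+ + 0 ℤ.- + 2)         ≈⟨ +-congˡ (-‿cong (h-≡ (shift a))) ⟩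
    orthogonalEntry a 0                                 ≈⟨ x-0#≈x _ ⟨
    orthogonalEntry a 0 - 0#                            ∎
    where
    a = rowOffset lam i
    shift : ∀ a → a ℤ.+ + 0 ℤ.- + 2 ≡ a ℤ.- + 0 ℤ.- + 2
    shift = solve-∀
  intermediate≈orthogonal-twoColumnsLeft lam i (suc zero) = begin
    h′ vs (a ℤ.+ + 1) + 1# * h′ vs (a ℤ.- + 1)
      ≈⟨ +-cong (+-congˡ (-‿cong (h-≡ (shift a)))) (*-identityˡ _) ⟩
    (h vs (a ℤ.+ + 1) - h vs (a ℤ.- + 1)) + (h vs (a ℤ.- + 1) - h vs (a ℤ.- + 1 ℤ.- + 2))
      ≈⟨ [x-y]+[y-w]≈x-w _ _ _ ⟩
    orthogonalEntry a 1
      ≈⟨ x-0#≈x _ ⟨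
    orthogonalEntry a 1 - 0# ∎
    where
    a = rowOffset lam i
    shift : ∀ a → a ℤ.+ + 1 ℤ.- + 2 ≡ a ℤ.- + 1
    shift = solve-∀
  intermediate≈orthogonal-twoColumnsLeft lam i (suc (suc j)) = begin
    h′ vs (a ℤ.+ (+ 2 ℤ.+ t)) + 1# * h′ vs (a ℤ.- (+ 2 ℤ.+ t))
      ≈⟨ +-cong (+-congˡ (-‿cong (h-≡ (shiftᵣ a t)))) (trans (*-identityˡ _) (+-congʳ (h-≡ (shiftₗ a t)))) ⟩
    (h vs (a ℤ.+ (+ 2 ℤ.+ t)) - h vs (a ℤ.+ t)) + (h vs (a ℤ.- t ℤ.- + 2) - h vs (a ℤ.- (+ 2 ℤ.+ t) ℤ.- + 2))
      ≈⟨ [x-y]+[u-w]≈[x-w]-[y-u] _ _ _ _ ⟩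
    orthogonalEntry a (toℕ (suc (suc j))) - orthogonalEntry a (toℕ j)
      ≡⟨ ≡.cong (λ q → orthogonalEntry a (toℕ (suc (suc j))) - orthogonalEntry a q)
           (≡.sym (≡.trans (toℕ-inject₁ (inject₁ j)) (toℕ-inject₁ j))) ⟩
    orthogonalEntry a (toℕ (suc (suc j))) - orthogonalEntry a (toℕ (inject₁ (inject₁ j))) ∎
    where
    a = rowOffset lam i
    t = + toℕ j
    shiftᵣ : ∀ a t → a ℤ.+ (+ 2 ℤ.+ t) ℤ.- + 2 ≡ a ℤ.+ t
    shiftᵣ = solve-∀
    shiftₗ : ∀ a t → a ℤ.- (+ 2 ℤ.+ t) ≡ a ℤ.- t ℤ.- + 2
    shiftₗ = solve-∀

  det-intermediate≈det-orthogonal : ∀ {n} (lam : Fin n → ℕ) →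
    det (intermediateMatrix lam) ≈ det (orthogonalMatrix lam)
  det-intermediate≈det-orthogonal lam = trans
    (det-cong (intermediate≈orthogonal-twoColumnsLeft lam))
    (det-subtract-earlier-columns (orthogonalMatrix lam) _ (twoColumnsLeft-earlier (orthogonalMatrix lam)))

  module _ {n} (m : ℕ) (lam : Vec ℕ n) where
    private
      Λ : Fin (n ℕ.+ m) → ℕ
      Λ = lookup (lam ++ replicate m 0)

    padded-bottomRow : ∀ k j → orthogonalMatrix Λ (n ↑ʳ k) j ≈ orthogonalEntry (+ 0 ℤ.- + (n ℕ.+ toℕ k)) (toℕ j)
    padded-bottomRow k j = reflexive (≡.cong₂ (λ λₖ p → orthogonalEntry (+ λₖ ℤ.- + p) (toℕ j))
      (≡.trans (Vec.lookup-++ʳ lam (replicate m 0) k) (Vec.lookup-replicate k 0)) (toℕ-↑ʳ n k))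

    padded-topLeft : ∀ i j → topLeft n m (orthogonalMatrix Λ) i j ≈ orthogonalMatrix (lookup lam) i j
    padded-topLeft i j = reflexive (≡.cong₂ orthogonalEntry
      (≡.cong₂ (λ λᵢ p → + λᵢ ℤ.- + p) (Vec.lookup-++ˡ lam (replicate m 0) i) (toℕ-↑ˡ i m)) (toℕ-↑ˡ j m))

    det-orthogonal-padded : det (orthogonalMatrix Λ) ≈ det (orthogonalMatrix (lookup lam))
    det-orthogonal-padded = begin
      det (orthogonalMatrix Λ)
        ≈⟨ det-block-triangular n m _ bottomLeft≈0 ⟩
      det (topLeft n m (orthogonalMatrix Λ)) * det (bottomRight n m (orthogonalMatrix Λ))
        ≈⟨ *-cong (det-cong padded-topLeft) (det-upper-unitriangular _ below≈0 diagonal≈1) ⟩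
      det (orthogonalMatrix (lookup lam)) * 1#
        ≈⟨ *-identityʳ _ ⟩
      det (orthogonalMatrix (lookup lam)) ∎
      where
      bottomLeft≈0 : ∀ k j → orthogonalMatrix Λ (n ↑ʳ k) (j ↑ˡ m) ≈ 0#
      bottomLeft≈0 k j = trans (padded-bottomRow k (j ↑ˡ m)) (orthogonalEntry-below
        (ℕ.<-≤-trans (≡.subst (ℕ._< n) (≡.sym (toℕ-↑ˡ j m)) (toℕ<n j)) (ℕ.m≤m+n n (toℕ k))))
      below≈0 : ∀ k l → toℕ l ℕ.< toℕ k → bottomRight n m (orthogonalMatrix Λ) k l ≈ 0#
      below≈0 k l l<k = trans (padded-bottomRow k (n ↑ʳ l)) (orthogonalEntry-below
        (≡.subst (ℕ._< n ℕ.+ toℕ k) (≡.sym (toℕ-↑ʳ n l)) (ℕ.+-monoʳ-< n l<k)))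
      diagonal≈1 : ∀ k → bottomRight n m (orthogonalMatrix Λ) k k ≈ 1#
      diagonal≈1 k = trans (padded-bottomRow k (n ↑ʳ k))
        (trans (reflexive (≡.cong (orthogonalEntry (+ 0 ℤ.- + (n ℕ.+ toℕ k))) (toℕ-↑ʳ n k))) (orthogonalEntry-diagonal (n ℕ.+ toℕ k)))

mainTheorem17 : ∀ {c ℓ} (R : CommutativeRing c ℓ) (n m : ℕ)
    (x xinv : Vec (CommutativeRing.Carrier R) n)
    (z : Vec (CommutativeRing.Carrier R) m) →
    (∀ (i : Fin n) → CommutativeRing._≈_ R (CommutativeRing._*_ R (lookup x i) (lookup xinv i)) (CommutativeRing.1# R)) →
    (lam : Vec ℕ n) → IsPartition lam →
    CommutativeRing._≈_ R
      (WithRing.o R (WithRing.vars R x xinv z) (lookup (lam ++ replicate m 0)))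
      (WithRing.krat R (WithRing.vars R x xinv z) (lookup lam))
mainTheorem17 R n m x xinv z _ lam _ =
  trans (det-orthogonal-padded m lam) (sym (det-intermediate≈det-orthogonal (lookup lam)))
  where
  open CommutativeRing R using (trans; sym)
  open Orthogonal R (WithRing.vars R x xinv z)
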